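{- Let $\mathcal{A}$ be a $p\times q$ matrix of formal power series in $\mathbb{R}[[x]]$. Then (a) $\mathrm{Lace}(\mathcal{A}^\perp) = \mathrm{Lace}(\mathcal{A})^\perp$; (b) $\mathcal{A}^\perp$ is fully interlacing if and only if $\mathcal{A}$ is fully interlacing.
   Context: A $\mathbb{Z}\times\mathbb{Z}$ real matrix is totally positive (TP) if every finite square submatrix has nonnegative determinant. For a $p\times q$ matrix $\mathcal{A} = (A_{ij}(x))_{0\le i<p,\,0\le j<q}$ of formal power series $A_{ij}(x) = \sum_{n\ge 0} a_{ij}(n)x^n$ (with $a_{ij}(n) = 0$ for $n<0$), $\mathrm{Lace}(\mathcal{A}) = (M_{uv})_{u,v\in\mathbb{Z}}$ is defined by writing $u = pu'+i$, $v = qv'+j$ with $u',v'\in\mathbb{Z}$, $0\le i<p$, $0\le j<q$, and setting $M_{uv} = a_{ij}(v'-u')$. $\mathcal{A}$ is fully interlacing if $\mathrm{Lace}(\mathcal{A})$ is TP. The flip $\mathcal{A}^\perp$ of the $p\times q$ matrix $\mathcal{A}$ is the $q\times p$ matrix $(A^\perp_{ji}(x))_{0\le j<q,\,0\le i<p}$ with $A^\perp_{ji}(x) = A_{p-1-i,\,q-1-j}(x)$ (reflection across the reverse diagonal). The flip of a $\mathbb{Z}\times\mathbb{Z}$ matrix $M=(M_{uv})$ is the $\mathbb{Z}\times\mathbb{Z}$ matrix $M^\perp$ with $M^\perp_{vu} = M_{ -1-u,\,-1-v}$ for all $u,v\in\mathbb{Z}$. -}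

module Defs where

open import Level using (0ℓ)
open import Data.Nat as ℕ using (ℕ; zero; suc; NonZero)
open import Data.Integer as ℤ using (ℤ; +_; -[1+_]; _/ℕ_; _%ℕ_)
open import Data.Integer.DivMod using (n%ℕd<d)
open import Data.Fin using (Fin; zero; suc; fromℕ<; toℕ; punchIn; opposite)
open import Data.Sum using (_⊎_)
open import Data.Product using (Σ; _×_; ∃)
open import Relation.Nullary using (¬_)
open import Relation.Binary.PropositionalEquality using (_≡_)
open import Algebra.Bundles using (CommutativeRing)

-- The real numbers, axiomatised as a (Dedekind-)complete ordered field.

record RealNumbers : Set₁ where
  field
    commRing : CommutativeRing 0ℓ 0ℓ
  open CommutativeRing commRing public
  field
    _≤_        : Carrier → Carrier → Set
    ≤-resp-≈   : ∀ {a a′ b b′} → a ≈ a′ → b ≈ b′ → a ≤ b → a′ ≤ b′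
    ≤-refl     : ∀ {a} → a ≤ a
    ≤-trans    : ∀ {a b c} → a ≤ b → b ≤ c → a ≤ c
    ≤-antisym  : ∀ {a b} → a ≤ b → b ≤ a → a ≈ b
    ≤-total    : ∀ a b → (a ≤ b) ⊎ (b ≤ a)
    +-mono-≤   : ∀ {a b} c → a ≤ b → (a + c) ≤ (b + c)
    *-nonneg   : ∀ {a b} → 0# ≤ a → 0# ≤ b → 0# ≤ (a * b)
    0≉1        : ¬ (0# ≈ 1#)
    inverse    : ∀ a → ¬ (a ≈ 0#) → Σ Carrier λ b → (a * b) ≈ 1#
    complete   : (P : Carrier → Set) →
                 (∀ {a b} → a ≈ b → P a → P b) →
                 Σ Carrier P →
                 Σ Carrier (λ b → ∀ a → P a → a ≤ b) →
                 Σ Carrier (λ s → (∀ a → P a → a ≤ s) ×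
                                  (∀ b → (∀ a → P a → a ≤ b) → s ≤ b))

module _ (ℝ : RealNumbers) where
  open RealNumbers ℝ using (Carrier; 0#; 1#; _+_; _*_; _-_; _≤_)

  PowerSeries : Set
  PowerSeries = ℕ → Carrier

  coeffℤ : PowerSeries → ℤ → Carrier
  coeffℤ a (+ n)     = a n
  coeffℤ a -[1+ n ]  = 0#

  PSMatrix : ℕ → ℕ → Set
  PSMatrix p q = Fin p → Fin q → PowerSeries

  ZMatrix : Set
  ZMatrix = ℤ → ℤ → Carrier

  flipPS : ∀ {p q} → PSMatrix p q → PSMatrix q p
  flipPS A j i = A (opposite i) (opposite j)

  flipZ : ZMatrix → ZMatrix
  flipZ M v u = M (ℤ.-1ℤ ℤ.- u) (ℤ.-1ℤ ℤ.- v)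

  -- u = p u' + i with 0 ≤ i < p  (floor division)
  quot : (u : ℤ) (p : ℕ) .{{_ : NonZero p}} → ℤ
  quot u p = u /ℕ p

  rem : (u : ℤ) (p : ℕ) .{{_ : NonZero p}} → Fin p
  rem u p = fromℕ< (n%ℕd<d u p)

  Lace : ∀ {p q} .{{_ : NonZero p}} .{{_ : NonZero q}} → PSMatrix p q → ZMatrix
  Lace {p} {q} A u v = coeffℤ (A (rem u p) (rem v q)) (quot v q ℤ.- quot u p)

  altSum : ∀ {n} → (Fin n → Carrier) → Carrier
  altSum {zero}  f = 0#
  altSum {suc n} f = f zero - altSum (λ j → f (suc j))

  det : ∀ n → (Fin n → Fin n → Carrier) → Carrier
  det zero    M = 1#
  det (suc n) M = altSum λ j → M zero j * det n (λ r c → M (suc r) (punchIn j c))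

  StrictlyIncreasing : ∀ {k} → (Fin k → ℤ) → Set
  StrictlyIncreasing {k} r = ∀ (a b : Fin k) → toℕ a ℕ.< toℕ b → r a ℤ.< r b

  TotallyPositive : ZMatrix → Set
  TotallyPositive M =
    ∀ (k : ℕ) (r c : Fin k → ℤ) → StrictlyIncreasing r → StrictlyIncreasing c →
    0# ≤ det k (λ a b → M (r a) (c b))

  FullyInterlacing : ∀ {p q} .{{_ : NonZero p}} .{{_ : NonZero q}} → PSMatrix p q → Set
  FullyInterlacing A = TotallyPositive (Lace A)

{-# OPTIONS --safe #-}
-- Writing u = p u′ + i with 0 ≤ i < p (floor division), the reflection u ↦ −1 − u sends
-- (u′, i) to (−1 − u′, p − 1 − i). Reflecting both indices of Lace(A) therefore swaps rows
-- and columns, reverses the residues and negates the difference of the quotients, which is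
-- exactly Lace(A^⊥).
--
-- For (b), the submatrix of M^⊥ on increasing rows r and columns c is the antitranspose of
-- the submatrix of M whose rows are −1 − c and whose columns are −1 − r, each listed in
-- reverse order so that they increase. Antitransposition preserves determinants: expanding
-- the antitranspose of S along its first row is expanding S along its last column.
module Submission where

open import Defs
open import Data.Nat using (ℕ; NonZero)
open import Data.Integer using (ℤ)
open import Data.Product using (_×_)
open import Function.Bundles using (_⇔_)
open import Relation.Binary.PropositionalEquality using (_≡_)

open import Data.Nat as ℕ using (zero; suc; _∸_; _%_; _/_)
import Data.Nat.Properties as ℕ
open import Data.Nat.DivMod using (m≡m%n+[m/n]*n; [m+kn]%n≡m%n; m<n⇒m%n≡m; m%n<n)
open import Data.Integer as ℤ using (+_; -[1+_]; -1ℤ; _/ℕ_; _%ℕ_)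
import Data.Integer.Properties as ℤ
open import Data.Integer.Tactic.RingSolver using (solve-∀)
open import Data.Fin using (Fin; zero; suc; fromℕ; inject₁; punchIn; opposite; toℕ)
open import Data.Fin.Properties using (opposite-prop; opposite-involutive; toℕ<n; toℕ-fromℕ<; toℕ-injective)
open import Data.Product using (_,_; proj₁; proj₂)
open import Data.Sum using (inj₁; inj₂)
open import Function using (_∘_)
open import Function.Bundles using (mk⇔)
import Function.Properties.Equivalence as ⇔
import Relation.Binary.PropositionalEquality as ≡

open ≡ using (cong; cong₂)

%-/-unique : ∀ m p {r q} .{{_ : NonZero p}} →
             r ℕ.< p → m ≡ r ℕ.+ q ℕ.* p → m % p ≡ r × m / p ≡ q
%-/-unique m p {r} {q} r<p m≡r+qp = m%p≡r , ℕ.*-cancelʳ-≡ (m / p) q p (ℕ.+-cancelˡ-≡ r _ _ r+[m/p]p≡r+qp)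
  where
  open ≡.≡-Reasoning
  m%p≡r : m % p ≡ r
  m%p≡r = begin
    m % p                ≡⟨ cong (_% p) m≡r+qp ⟩
    (r ℕ.+ q ℕ.* p) % p  ≡⟨ [m+kn]%n≡m%n r q p ⟩
    r % p                ≡⟨ m<n⇒m%n≡m r<p ⟩
    r                    ∎
  r+[m/p]p≡r+qp : r ℕ.+ m / p ℕ.* p ≡ r ℕ.+ q ℕ.* p
  r+[m/p]p≡r+qp = begin
    r ℕ.+ m / p ℕ.* p      ≡⟨ cong (ℕ._+ m / p ℕ.* p) m%p≡r ⟨
    m % p ℕ.+ m / p ℕ.* p  ≡⟨ m≡m%n+[m/n]*n m p ⟨
    m                      ≡⟨ m≡r+qp ⟩
    r ℕ.+ q ℕ.* p          ∎

-[1+n]/ℕ-%ℕ : ∀ n p .{{_ : NonZero p}} →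
              -[1+ n ] /ℕ p ≡ -[1+ n / p ] × -[1+ n ] %ℕ p ≡ p ∸ suc (n % p)
-[1+n]/ℕ-%ℕ n p with ℕ.m≤n⇒m<n∨m≡n (m%n<n n p)
... | inj₁ 1+n%p<p with %-/-unique (suc n) p 1+n%p<p (cong suc (m≡m%n+[m/n]*n n p))
...   | [1+n]%p≡ , [1+n]/p≡ rewrite [1+n]%p≡ | [1+n]/p≡ = ≡.refl , ≡.refl
-[1+n]/ℕ-%ℕ n p | inj₂ 1+n%p≡p
  with %-/-unique (suc n) p {0} {suc (n / p)} (ℕ.>-nonZero⁻¹ p)
         (≡.trans (cong suc (m≡m%n+[m/n]*n n p)) (cong (ℕ._+ n / p ℕ.* p) 1+n%p≡p))
...   | [1+n]%p≡ , [1+n]/p≡ rewrite [1+n]%p≡ | [1+n]/p≡ =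
  ≡.refl , ≡.sym (≡.trans (cong (p ∸_) 1+n%p≡p) (ℕ.n∸n≡0 p))

-1-n≡-[1+n] : ∀ n → -1ℤ ℤ.- + n ≡ -[1+ n ]
-1-n≡-[1+n] zero    = ≡.refl
-1-n≡-[1+n] (suc n) = ≡.refl

/ℕ-reflect : ∀ v p .{{_ : NonZero p}} → (-1ℤ ℤ.- v) /ℕ p ≡ -1ℤ ℤ.- v /ℕ p
/ℕ-reflect (+ n) p = begin
  (-1ℤ ℤ.- + n) /ℕ p  ≡⟨ cong (_/ℕ p) (-1-n≡-[1+n] n) ⟩
  -[1+ n ] /ℕ p       ≡⟨ proj₁ (-[1+n]/ℕ-%ℕ n p) ⟩
  -[1+ n / p ]        ≡⟨ -1-n≡-[1+n] (n / p) ⟨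
  -1ℤ ℤ.- + (n / p)   ∎
  where open ≡.≡-Reasoning
/ℕ-reflect -[1+ n ] p = ≡.sym (cong (λ x → -1ℤ ℤ.- x) (proj₁ (-[1+n]/ℕ-%ℕ n p)))

[-1-a]-[-1-b]≡b-a : ∀ a b → (-1ℤ ℤ.- a) ℤ.- (-1ℤ ℤ.- b) ≡ b ℤ.- a
[-1-a]-[-1-b]≡b-a = solve-∀

-1-[-1-a]≡a : ∀ a → -1ℤ ℤ.- (-1ℤ ℤ.- a) ≡ a
-1-[-1-a]≡a = solve-∀

punchIn-fromℕ : ∀ {n} (i : Fin n) → punchIn (fromℕ n) i ≡ inject₁ i
punchIn-fromℕ zero    = ≡.refl
punchIn-fromℕ (suc i) = cong suc (punchIn-fromℕ i)

punchIn-inject₁-fromℕ : ∀ {n} (i : Fin (suc n)) → punchIn (inject₁ i) (fromℕ n) ≡ fromℕ (suc n)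
punchIn-inject₁-fromℕ zero            = ≡.refl
punchIn-inject₁-fromℕ {suc n} (suc i) = cong suc (punchIn-inject₁-fromℕ i)

inject₁-punchIn : ∀ {n} (i : Fin (suc n)) (j : Fin n) →
                  inject₁ (punchIn i j) ≡ punchIn (inject₁ i) (inject₁ j)
inject₁-punchIn zero    j       = ≡.refl
inject₁-punchIn (suc i) zero    = ≡.refl
inject₁-punchIn (suc i) (suc j) = cong suc (inject₁-punchIn i j)

opposite-inject₁ : ∀ {n} (i : Fin (suc n)) → opposite (inject₁ i) ≡ suc (opposite i)
opposite-inject₁ zero            = ≡.refl
opposite-inject₁ {suc n} (suc i) = cong inject₁ (opposite-inject₁ i)

opposite-punchIn : ∀ {n} (i : Fin (suc n)) (j : Fin n) →
                   opposite (punchIn i j) ≡ punchIn (opposite i) (opposite j)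
opposite-punchIn zero            j       = ≡.sym (punchIn-fromℕ (opposite j))
opposite-punchIn {suc n} (suc i) zero    = ≡.sym (punchIn-inject₁-fromℕ (opposite i))
opposite-punchIn (suc i)         (suc j) =
  ≡.trans (cong inject₁ (opposite-punchIn i j)) (inject₁-punchIn (opposite i) (opposite j))

module Determinant (ℝ : RealNumbers) where
  open RealNumbers ℝ hiding (zero)
  open import Algebra.Properties.Ring ring using (-0#≈0#; x[y-z]≈xy-xz)
  open import Algebra.Properties.AbelianGroup +-abelianGroup using (⁻¹-∙-comm)
  open import Algebra.Properties.CommutativeSemigroup +-commutativeSemigroup using (interchange)
  open import Algebra.Properties.CommutativeSemigroup *-commutativeSemigroup using (x∙yz≈y∙xz)
  open import Relation.Binary.Reasoning.Setoid setoid

  Matrix : ℕ → Set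
  Matrix n = Fin n → Fin n → Carrier

  neg^ : ℕ → Carrier → Carrier
  neg^ zero    x = x
  neg^ (suc k) x = - neg^ k x

  neg^-cong : ∀ k {x y} → x ≈ y → neg^ k x ≈ neg^ k y
  neg^-cong zero    x≈y = x≈y
  neg^-cong (suc k) x≈y = -‿cong (neg^-cong k x≈y)

  altSum-cong : ∀ {n} {f g : Fin n → Carrier} → (∀ i → f i ≈ g i) → altSum ℝ f ≈ altSum ℝ g
  altSum-cong {zero}  f≈g = refl
  altSum-cong {suc n} f≈g = +-cong (f≈g zero) (-‿cong (altSum-cong (f≈g ∘ suc)))

  altSum-zero : ∀ n → altSum ℝ {n} (λ _ → 0#) ≈ 0#
  altSum-zero zero    = refl
  altSum-zero (suc n) = trans (+-congˡ (-‿cong (altSum-zero n))) (-‿inverseʳ 0#)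

  altSum-distrib-+ : ∀ {n} (f g : Fin n → Carrier) →
                     altSum ℝ (λ i → f i + g i) ≈ altSum ℝ f + altSum ℝ g
  altSum-distrib-+ {zero}  f g = sym (+-identityˡ 0#)
  altSum-distrib-+ {suc n} f g = begin
    f zero + g zero - altSum ℝ (λ i → f (suc i) + g (suc i))
      ≈⟨ +-congˡ (-‿cong (altSum-distrib-+ (f ∘ suc) (g ∘ suc))) ⟩
    f zero + g zero - (altSum ℝ (f ∘ suc) + altSum ℝ (g ∘ suc))
      ≈⟨ +-congˡ (⁻¹-∙-comm _ _) ⟨
    f zero + g zero + (- altSum ℝ (f ∘ suc) + - altSum ℝ (g ∘ suc))
      ≈⟨ interchange _ _ _ _ ⟩
    (f zero - altSum ℝ (f ∘ suc)) + (g zero - altSum ℝ (g ∘ suc)) ∎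

  -‿distrib-altSum : ∀ {n} (f : Fin n → Carrier) → - altSum ℝ f ≈ altSum ℝ (λ i → - f i)
  -‿distrib-altSum {zero}  f = -0#≈0#
  -‿distrib-altSum {suc n} f = begin
    - (f zero - altSum ℝ (f ∘ suc))        ≈⟨ ⁻¹-∙-comm _ _ ⟨
    - f zero - - altSum ℝ (f ∘ suc)        ≈⟨ +-congˡ (-‿cong (-‿distrib-altSum (f ∘ suc))) ⟩
    - f zero - altSum ℝ (λ i → - f (suc i)) ∎

  *-distribˡ-altSum : ∀ {n} x (f : Fin n → Carrier) → x * altSum ℝ f ≈ altSum ℝ (λ i → x * f i)
  *-distribˡ-altSum {zero}  x f = zeroʳ x
  *-distribˡ-altSum {suc n} x f =
    trans (x[y-z]≈xy-xz x _ _) (+-congˡ (-‿cong (*-distribˡ-altSum x (f ∘ suc))))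

  altSum-comm : ∀ {m n} (f : Fin m → Fin n → Carrier) →
                altSum ℝ (λ i → altSum ℝ (f i)) ≈ altSum ℝ (λ j → altSum ℝ (λ i → f i j))
  altSum-comm {zero}  {n} f = sym (altSum-zero n)
  altSum-comm {suc m} {n} f = begin
    altSum ℝ (f zero) - altSum ℝ (λ i → altSum ℝ (f (suc i)))
      ≈⟨ +-congˡ (-‿cong (altSum-comm (f ∘ suc))) ⟩
    altSum ℝ (f zero) - altSum ℝ (λ j → altSum ℝ (λ i → f (suc i) j))
      ≈⟨ +-congˡ (-‿distrib-altSum (λ j → altSum ℝ (λ i → f (suc i) j))) ⟩
    altSum ℝ (f zero) + altSum ℝ (λ j → - altSum ℝ (λ i → f (suc i) j))
      ≈⟨ altSum-distrib-+ (f zero) _ ⟨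
    altSum ℝ (λ j → altSum ℝ (λ i → f i j)) ∎

  altSum-init-last : ∀ n (f : Fin (suc n) → Carrier) →
                     altSum ℝ f ≈ altSum ℝ (f ∘ inject₁) + neg^ n (f (fromℕ n))
  altSum-init-last zero    f = trans (+-congˡ -0#≈0#) (trans (+-identityʳ _) (sym (+-identityˡ _)))
  altSum-init-last (suc n) f = begin
    f zero - altSum ℝ (f ∘ suc)
      ≈⟨ +-congˡ (-‿cong (altSum-init-last n (f ∘ suc))) ⟩
    f zero - (altSum ℝ (f ∘ suc ∘ inject₁) + neg^ n (f (fromℕ (suc n))))
      ≈⟨ +-congˡ (⁻¹-∙-comm _ _) ⟨
    f zero + (- altSum ℝ (f ∘ suc ∘ inject₁) - neg^ n (f (fromℕ (suc n))))
      ≈⟨ +-assoc _ _ _ ⟨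
    altSum ℝ (f ∘ inject₁) + neg^ (suc n) (f (fromℕ (suc n))) ∎

  altSum-interchange : ∀ {m n} (x : Fin m → Carrier) (y : Fin n → Carrier)
                       (D : Fin m → Fin n → Carrier) →
                       altSum ℝ (λ i → x i * altSum ℝ (λ j → y j * D i j)) ≈
                       altSum ℝ (λ j → y j * altSum ℝ (λ i → x i * D i j))
  altSum-interchange x y D = begin
    altSum ℝ (λ i → x i * altSum ℝ (λ j → y j * D i j))
      ≈⟨ altSum-cong (λ i → *-distribˡ-altSum (x i) (λ j → y j * D i j)) ⟩
    altSum ℝ (λ i → altSum ℝ (λ j → x i * (y j * D i j)))
      ≈⟨ altSum-cong (λ i → altSum-cong (λ j → x∙yz≈y∙xz (x i) (y j) (D i j))) ⟩
    altSum ℝ (λ i → altSum ℝ (λ j → y j * (x i * D i j)))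
      ≈⟨ altSum-comm (λ i j → y j * (x i * D i j)) ⟩
    altSum ℝ (λ j → altSum ℝ (λ i → y j * (x i * D i j)))
      ≈⟨ altSum-cong (λ j → *-distribˡ-altSum (y j) (λ i → x i * D i j)) ⟨
    altSum ℝ (λ j → y j * altSum ℝ (λ i → x i * D i j)) ∎

  det-cong : ∀ n {M N : Matrix n} → (∀ i j → M i j ≈ N i j) → det ℝ n M ≈ det ℝ n N
  det-cong zero    M≈N = refl
  det-cong (suc n) M≈N =
    altSum-cong λ j → *-cong (M≈N zero j) (det-cong n (λ r c → M≈N (suc r) (punchIn j c)))

  firstRowMinor : ∀ {n} → Matrix (suc n) → Fin (suc n) → Matrix n
  firstRowMinor S j r c = S (suc r) (punchIn j c)

  lastColumnMinor : ∀ {n} → Matrix (suc n) → Fin (suc n) → Matrix n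
  lastColumnMinor S i r c = S (punchIn i r) (inject₁ c)

  -- Row i = n − b meets column n, so its cofactor sign (−1)^(i + n) is the (−1)^b of altSum.
  lastColumnExpansion : ∀ n → Matrix (suc n) → Carrier
  lastColumnExpansion n S =
    altSum ℝ (λ b → S (opposite b) (fromℕ n) * det ℝ n (lastColumnMinor S (opposite b)))

  det≈lastColumnExpansion : ∀ n (S : Matrix (suc n)) → det ℝ (suc n) S ≈ lastColumnExpansion n S
  det≈lastColumnExpansion zero    S = refl
  det≈lastColumnExpansion (suc m) S = begin
    altSum ℝ F
      ≈⟨ altSum-init-last (suc m) F ⟩
    altSum ℝ (F ∘ inject₁) + neg^ (suc m) (F L)
      ≈⟨ +-cong initialTerms (neg^-cong (suc m) lastTerm) ⟩
    altSum ℝ (λ b → G (suc (opposite b))) + neg^ (suc m) (G zero)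
      ≈⟨ +-cong (altSum-cong λ b → reflexive (cong G (opposite-inject₁ b)))
                (neg^-cong (suc m) (reflexive (cong G (opposite-involutive zero)))) ⟨
    altSum ℝ (G ∘ opposite ∘ inject₁) + neg^ (suc m) (G (opposite L))
      ≈⟨ altSum-init-last (suc m) (G ∘ opposite) ⟨
    lastColumnExpansion (suc m) S ∎
    where
    L : Fin (suc (suc m))
    L = fromℕ (suc m)
    F : Fin (suc (suc m)) → Carrier
    F j = S zero j * det ℝ (suc m) (firstRowMinor S j)
    G : Fin (suc (suc m)) → Carrier
    G i = S i L * det ℝ (suc m) (lastColumnMinor S i)

    lastTerm : F L ≈ G zero
    lastTerm = *-congˡ (det-cong (suc m) λ r c → reflexive (cong (S (suc r)) (punchIn-fromℕ c)))

    D : Fin (suc m) → Fin (suc m) → Carrier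
    D j b = det ℝ m (λ r c → S (suc (punchIn (opposite b) r)) (inject₁ (punchIn j c)))

    firstRowMinor-expansion : ∀ j →
      det ℝ (suc m) (firstRowMinor S (inject₁ j)) ≈ altSum ℝ (λ b → S (suc (opposite b)) L * D j b)
    firstRowMinor-expansion j =
      trans (det≈lastColumnExpansion m (firstRowMinor S (inject₁ j))) (altSum-cong λ b →
      *-cong (reflexive (cong (S (suc (opposite b))) (punchIn-inject₁-fromℕ j)))
             (det-cong m λ r c → reflexive (cong (S (suc (punchIn (opposite b) r))) (≡.sym (inject₁-punchIn j c)))))

    initialTerms : altSum ℝ (F ∘ inject₁) ≈ altSum ℝ (λ b → G (suc (opposite b)))
    initialTerms = trans (altSum-cong λ j → *-congˡ {S zero (inject₁ j)} (firstRowMinor-expansion j))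
                         (altSum-interchange (λ j → S zero (inject₁ j)) (λ b → S (suc (opposite b)) L) D)

  antitranspose : ∀ {n} → Matrix n → Matrix n
  antitranspose S i j = S (opposite j) (opposite i)

  det-antitranspose : ∀ n (S : Matrix n) → det ℝ n (antitranspose S) ≈ det ℝ n S
  det-antitranspose zero    S = refl
  det-antitranspose (suc m) S =
    trans (altSum-cong λ b → *-congˡ {S (opposite b) (fromℕ m)} (minor b)) (sym (det≈lastColumnExpansion m S))
    where
    minor : ∀ b → det ℝ m (firstRowMinor (antitranspose S) b) ≈ det ℝ m (lastColumnMinor S (opposite b))
    minor b = trans
      (det-cong m λ r c → reflexive (cong (λ i → S i (inject₁ (opposite r))) (opposite-punchIn b c)))
      (det-antitranspose m (lastColumnMinor S (opposite b)))

module _ (ℝ : RealNumbers) where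
  open Determinant ℝ using (det-cong; det-antitranspose)
  module R = RealNumbers ℝ

  rem-[1+n] : ∀ n p .{{_ : NonZero p}} → rem ℝ -[1+ n ] p ≡ opposite (rem ℝ (+ n) p)
  rem-[1+n] n p = toℕ-injective (begin
    toℕ (rem ℝ -[1+ n ] p)          ≡⟨ toℕ-fromℕ< _ ⟩
    -[1+ n ] %ℕ p                   ≡⟨ proj₂ (-[1+n]/ℕ-%ℕ n p) ⟩
    p ∸ suc (n % p)                 ≡⟨ cong (λ r → p ∸ suc r) (toℕ-fromℕ< _) ⟨
    p ∸ suc (toℕ (rem ℝ (+ n) p))   ≡⟨ opposite-prop (rem ℝ (+ n) p) ⟨
    toℕ (opposite (rem ℝ (+ n) p))  ∎)
    where open ≡.≡-Reasoning

  rem-reflect : ∀ v p .{{_ : NonZero p}} → rem ℝ (-1ℤ ℤ.- v) p ≡ opposite (rem ℝ v p)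
  rem-reflect (+ n)    p = ≡.trans (cong (λ u → rem ℝ u p) (-1-n≡-[1+n] n)) (rem-[1+n] n p)
  rem-reflect -[1+ n ] p =
    ≡.trans (≡.sym (opposite-involutive (rem ℝ (+ n) p))) (cong opposite (≡.sym (rem-[1+n] n p)))

  Lace-flipPS : ∀ {p q} .{{_ : NonZero p}} .{{_ : NonZero q}} (A : PSMatrix ℝ p q) (u v : ℤ) →
                Lace ℝ (flipPS ℝ A) u v ≡ flipZ ℝ (Lace ℝ A) u v
  Lace-flipPS {p} {q} A u v = begin
    coeffℤ ℝ (A (opposite (rem ℝ v p)) (opposite (rem ℝ u q))) (v /ℕ p ℤ.- u /ℕ q)
      ≡⟨ cong (coeffℤ ℝ (A (opposite (rem ℝ v p)) (opposite (rem ℝ u q)))) ([-1-a]-[-1-b]≡b-a (u /ℕ q) (v /ℕ p)) ⟨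
    coeffℤ ℝ (A (opposite (rem ℝ v p)) (opposite (rem ℝ u q))) ((-1ℤ ℤ.- u /ℕ q) ℤ.- (-1ℤ ℤ.- v /ℕ p))
      ≡⟨ cong₂ (λ i j → coeffℤ ℝ (A i j) ((-1ℤ ℤ.- u /ℕ q) ℤ.- (-1ℤ ℤ.- v /ℕ p))) (rem-reflect v p) (rem-reflect u q) ⟨
    coeffℤ ℝ (A (rem ℝ (-1ℤ ℤ.- v) p) (rem ℝ (-1ℤ ℤ.- u) q)) ((-1ℤ ℤ.- u /ℕ q) ℤ.- (-1ℤ ℤ.- v /ℕ p))
      ≡⟨ cong₂ (λ a b → coeffℤ ℝ (A (rem ℝ (-1ℤ ℤ.- v) p) (rem ℝ (-1ℤ ℤ.- u) q)) (a ℤ.- b)) (/ℕ-reflect u q) (/ℕ-reflect v p) ⟨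
    coeffℤ ℝ (A (rem ℝ (-1ℤ ℤ.- v) p) (rem ℝ (-1ℤ ℤ.- u) q)) ((-1ℤ ℤ.- u) /ℕ q ℤ.- (-1ℤ ℤ.- v) /ℕ p) ∎
    where open ≡.≡-Reasoning

  reverse-reflect : ∀ {k} → (Fin k → ℤ) → Fin k → ℤ
  reverse-reflect s i = -1ℤ ℤ.- s (opposite i)

  StrictlyIncreasing-reverse-reflect : ∀ {k} {s : Fin k → ℤ} →
    StrictlyIncreasing ℝ s → StrictlyIncreasing ℝ (reverse-reflect s)
  StrictlyIncreasing-reverse-reflect {k} {s} s↑ a b a<b =
    ℤ.+-monoʳ-< -1ℤ (ℤ.neg-mono-< (s↑ (opposite b) (opposite a) opposite-reverses))
    where
    opposite-reverses : toℕ (opposite b) ℕ.< toℕ (opposite a)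
    opposite-reverses = ≡.subst₂ ℕ._<_ (≡.sym (opposite-prop b)) (≡.sym (opposite-prop a))
                                 (ℕ.∸-monoʳ-< (ℕ.s≤s a<b) (toℕ<n b))

  TotallyPositive-resp : ∀ {M N} → (∀ u v → M u v ≡ N u v) →
                         TotallyPositive ℝ M → TotallyPositive ℝ N
  TotallyPositive-resp M≡N M-TP k r c r↑ c↑ =
    R.≤-resp-≈ R.refl (det-cong k λ a b → R.reflexive (M≡N (r a) (c b))) (M-TP k r c r↑ c↑)

  TotallyPositive-flipZ : ∀ {M} → TotallyPositive ℝ M → TotallyPositive ℝ (flipZ ℝ M)
  TotallyPositive-flipZ {M} M-TP k r c r↑ c↑ = R.≤-resp-≈ R.refl antitransposed-minor
    (M-TP k (reverse-reflect c) (reverse-reflect r)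
          (StrictlyIncreasing-reverse-reflect c↑) (StrictlyIncreasing-reverse-reflect r↑))
    where
    antitransposed-minor : det ℝ k (λ a b → M (reverse-reflect c a) (reverse-reflect r b)) R.≈
                           det ℝ k (λ a b → flipZ ℝ M (r a) (c b))
    antitransposed-minor = R.trans (R.sym (det-antitranspose k _)) (det-cong k λ a b → R.reflexive
      (cong₂ (λ i j → M (-1ℤ ℤ.- c i) (-1ℤ ℤ.- r j)) (opposite-involutive b) (opposite-involutive a)))

  flipZ-involutive : ∀ M (u v : ℤ) → flipZ ℝ (flipZ ℝ M) u v ≡ M u v
  flipZ-involutive M u v = cong₂ M (-1-[-1-a]≡a u) (-1-[-1-a]≡a v)

  TotallyPositive-flipZ⇔ : ∀ M → TotallyPositive ℝ (flipZ ℝ M) ⇔ TotallyPositive ℝ M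
  TotallyPositive-flipZ⇔ M =
    mk⇔ (TotallyPositive-resp (flipZ-involutive M) ∘ TotallyPositive-flipZ {flipZ ℝ M}) (TotallyPositive-flipZ {M})

theorem4p1 : (ℝ : RealNumbers) (p q : ℕ) .{{_ : NonZero p}} .{{_ : NonZero q}}
    (A : PSMatrix ℝ p q) →
    ((u v : ℤ) → Lace ℝ (flipPS ℝ A) u v ≡ flipZ ℝ (Lace ℝ A) u v)
    × (FullyInterlacing ℝ (flipPS ℝ A) ⇔ FullyInterlacing ℝ A)
theorem4p1 ℝ p q A = Lace-flipPS ℝ A , ⇔.trans
  (mk⇔ (TotallyPositive-resp ℝ (Lace-flipPS ℝ A))
       (TotallyPositive-resp ℝ (λ u v → ≡.sym (Lace-flipPS ℝ A u v))))
  (TotallyPositive-flipZ⇔ ℝ (Lace ℝ A))
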